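{- Let $G$ be a graph such that $f(G)\le 2$. Then $|V(G)|\ge \chi(G)+2f(G)$.
   Context: All graphs are finite, undirected, without loops or multiple edges. $\omega(G)$ is the clique number and $\chi(G)$ the chromatic number of $G$; $f(G)=\chi(G)-\omega(G)$. -}

module Defs where

open import Data.Nat using (ℕ; _≤_; _∸_; _+_; _*_)
open import Data.Fin using (Fin)
open import Data.Bool using (Bool; true; false)
open import Data.Product using (Σ; _×_)
open import Relation.Binary.PropositionalEquality using (_≡_; _≢_)
open import Function.Definitions using (Injective)

record Graph (n : ℕ) : Set where
  field
    adj   : Fin n → Fin n → Bool
    sym   : ∀ i j → adj i j ≡ adj j i
    irrefl : ∀ i → adj i i ≡ false

open Graph public

Adj : ∀ {n} → Graph n → Fin n → Fin n → Set
Adj G i j = adj G i j ≡ true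

HasClique : ∀ {n} → Graph n → ℕ → Set
HasClique {n} G k =
  Σ (Fin k → Fin n) λ v → Injective _≡_ _≡_ v × (∀ a b → a ≢ b → Adj G (v a) (v b))

Colorable : ∀ {n} → Graph n → ℕ → Set
Colorable {n} G k =
  Σ (Fin n → Fin k) λ c → ∀ i j → Adj G i j → c i ≢ c j

IsCliqueNumber : ∀ {n} → Graph n → ℕ → Set
IsCliqueNumber G k = HasClique G k × (∀ m → HasClique G m → m ≤ k)

IsChromaticNumber : ∀ {n} → Graph n → ℕ → Set
IsChromaticNumber G k = Colorable G k × (∀ m → Colorable G m → k ≤ m)

module Submission where

-- Fix a proper colouring c with χ = χ(G) colours.  Every colour is used, so each
-- class has a representative; the remaining n ∸ χ vertices are called extra.  It
-- suffices to show that at most one extra vertex yields a clique of size χ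
-- (so f = 0), and two or three extra vertices a clique of size χ ∸ 1 (so f ≤ 1);
-- with four or more, the hypothesis f ≤ 2 already gives n ≥ χ + 2f.
--
-- The one tool is recolouring: as no proper colouring uses fewer than χ colours,
-- no list of vertex moves can keep the colouring proper while emptying a class
-- (`cannotFree`).  It shows that singleton classes are pairwise adjacent, that each
-- two-element class has a member adjacent to all singleton classes (a good vertex),
-- and, for three two-element classes, the further adjacencies needed there.
-- Cliques are assembled from transversals of the colour classes.

open import Defs hiding (sym)
open import Data.Nat using (ℕ; suc; _≤_; _∸_; _+_; _*_)
open import Data.Nat.Properties
  using (≤-trans; n≤1+n; 1+n≰n; m≤n+m∸n; m≤n+o⇒m∸n≤o; +-monoʳ-≤; +-monoˡ-≤; *-monoʳ-≤; +-comm)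
open import Data.Fin using (Fin; zero; suc; punchIn; punchOut)
open import Data.Fin.Properties
  using (_≟_; punchIn-injective; punchInᵢ≢i; punchOut-injective; injective⇒≤)
import Data.Fin.Properties as Fin
open import Data.Bool using (true)
import Data.Bool.Properties as Bool
open import Data.Product using (∃; _×_; _,_; proj₁; proj₂)
open import Data.Sum using (_⊎_; inj₁; inj₂; swap; map₂)
open import Data.Empty using (⊥; ⊥-elim)
open import Data.List using (List; []; _∷_; length)
open import Data.List.Membership.Propositional using (_∈_; _∉_)
open import Data.List.Relation.Unary.Any using (Any; here; there)
import Data.List.Relation.Unary.Any as Any
open import Data.List.Relation.Unary.All using (All; []; _∷_)
import Data.List.Relation.Unary.All as All
open import Data.List.Relation.Unary.All.Properties using (¬Any⇒All¬)
open import Data.List.Relation.Unary.AllPairs using (AllPairs; []; _∷_)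
import Data.Vec.Functional as Vector
open import Relation.Nullary using (¬_; Dec; yes; no)
open import Relation.Nullary.Decidable using (_×-dec_; _→-dec_; ¬?; decidable-stable)
open import Relation.Binary.PropositionalEquality using (_≡_; _≢_; refl; sym; trans; cong; subst)
open import Function using (_∘_)
open import Function.Definitions using (Injective)

module GraphFacts {n : ℕ} (G : Graph n) where

  adj? : (i j : Fin n) → Dec (Adj G i j)
  adj? i j = adj G i j Bool.≟ true

  Adj-sym : ∀ {i j} → Adj G i j → Adj G j i
  Adj-sym {i} {j} a = trans (Graph.sym G j i) a

  Adj-irrefl : ∀ i → ¬ Adj G i i
  Adj-irrefl i a with trans (sym a) (irrefl G i)
  ... | ()

  ¬Adj-≡ : ∀ {m w x} → w ≡ x → ¬ Adj G m x → ¬ Adj G m w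
  ¬Adj-≡ refl na = na

Proper : ∀ {n k} → Graph n → (Fin n → Fin k) → Set
Proper G d = ∀ i j → Adj G i j → d i ≢ d j

-- If every proper colouring of G needs at least k colours, then a proper
-- k-colouring uses every colour: an unused colour could be deleted.
noUnusedColour : ∀ {n k} (G : Graph n) → (∀ m → Colorable G m → k ≤ m)
  → (d : Fin n → Fin k) → Proper G d → (q : Fin k) → (∀ v → d v ≢ q) → ⊥
noUnusedColour {n} {suc k} G minimal d proper q unused =
  1+n≰n (minimal k (deleted , λ i j a eq → proper i j a (punchOut-injective (q≢ i) (q≢ j) eq)))
  where
  q≢ : ∀ v → q ≢ d v
  q≢ v e = unused v (sym e)

  deleted : Fin n → Fin k
  deleted v = punchOut (q≢ v)

omit : ∀ {k} → Fin k → Fin (k ∸ 1) → Fin k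
omit {suc k} q = punchIn q

omit-injective : ∀ {k} (q : Fin k) → Injective _≡_ _≡_ (omit q)
omit-injective {suc k} q {i} {j} = punchIn-injective q i j

omit-≢ : ∀ {k} (q : Fin k) i → omit q i ≢ q
omit-≢ {suc k} q = punchInᵢ≢i q

module Counting {n : ℕ} where

  Avoids : ∀ {m} → (Fin m → Fin n) → Fin n → Set
  Avoids f v = ∀ i → f i ≢ v

  ∷-injective : ∀ {m v} {f : Fin m → Fin n} → Injective _≡_ _≡_ f → Avoids f v
    → Injective _≡_ _≡_ (v Vector.∷ f)
  ∷-injective f-inj f-avoids {zero}  {zero}  _ = refl
  ∷-injective f-inj f-avoids {zero}  {suc j} e = ⊥-elim (f-avoids j (sym e))
  ∷-injective f-inj f-avoids {suc i} {zero}  e = ⊥-elim (f-avoids i e)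
  ∷-injective f-inj f-avoids {suc i} {suc j} e = cong suc (f-inj e)

  prepend : ∀ {m} (es : List (Fin n)) → (Fin m → Fin n) → Fin (length es + m) → Fin n
  prepend []       f = f
  prepend (e ∷ es) f = e Vector.∷ prepend es f

  prepend-avoids : ∀ {m v} {f : Fin m → Fin n} (es : List (Fin n))
    → Avoids f v → All (v ≢_) es → Avoids (prepend es f) v
  prepend-avoids []       f-avoids _           i       = f-avoids i
  prepend-avoids (e ∷ es) f-avoids (v≢e ∷ _)   zero    = λ e≡v → v≢e (sym e≡v)
  prepend-avoids (e ∷ es) f-avoids (_ ∷ v≢es)  (suc i) = prepend-avoids es f-avoids v≢es i

  prepend-injective : ∀ {m} {f : Fin m → Fin n} (es : List (Fin n))
    → Injective _≡_ _≡_ f → AllPairs _≢_ es → All (Avoids f) es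
    → Injective _≡_ _≡_ (prepend es f)
  prepend-injective []       f-inj _                   _ = f-inj
  prepend-injective (e ∷ es) f-inj (e≢es ∷ distinct) (f-avoids-e ∷ f-avoids-es) =
    ∷-injective (prepend-injective es f-inj distinct f-avoids-es)
                (prepend-avoids es f-avoids-e e≢es)

  freshPoints-≤ : ∀ {m} {f : Fin m → Fin n} (es : List (Fin n))
    → Injective _≡_ _≡_ f → AllPairs _≢_ es → All (Avoids f) es → length es + m ≤ n
  freshPoints-≤ es f-inj distinct avoid = injective⇒≤ (prepend-injective es f-inj distinct avoid)

deficit-≤ : ∀ χ j ω → χ ∸ j ≤ ω → χ ∸ ω ≤ j
deficit-≤ χ j ω h =
  m≤n+o⇒m∸n≤o χ ω (≤-trans (m≤n+m∸n χ j) (subst (_≤ ω + j) (+-comm (χ ∸ j) j) (+-monoˡ-≤ j h)))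

deficitBound : ∀ {χ ω n} k → χ ∸ ω ≤ k → 2 * k + χ ≤ n → χ + 2 * (χ ∸ ω) ≤ n
deficitBound {χ} {n = n} k f≤k h =
  ≤-trans (+-monoʳ-≤ χ (*-monoʳ-≤ 2 f≤k)) (subst (_≤ n) (+-comm (2 * k) χ) h)

allPairs-∈ : ∀ {A : Set} {R : A → A → Set} {xs : List A} {x y : A}
  → AllPairs R xs → x ∈ xs → y ∈ xs → x ≡ y ⊎ R x y ⊎ R y x
allPairs-∈ (_  ∷ _)    (here refl) (here refl) = inj₁ refl
allPairs-∈ (Rx ∷ _)    (here refl) (there y∈)  = inj₂ (inj₁ (All.lookup Rx y∈))
allPairs-∈ (Ry ∷ _)    (there x∈)  (here refl) = inj₂ (inj₂ (All.lookup Ry x∈))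
allPairs-∈ (_  ∷ rest) (there x∈)  (there y∈)  = allPairs-∈ rest x∈ y∈

module OptimalColouring {n : ℕ} (G : Graph n) {χ : ℕ} (c : Fin n → Fin χ)
  (proper : Proper G c) (minimal : ∀ m → Colorable G m → χ ≤ m) where

  open GraphFacts G
  open Counting {n}

  sameColour-¬Adj : ∀ {u v} → c u ≡ c v → ¬ Adj G u v
  sameColour-¬Adj {u} {v} e a = proper u v a e

  -- Recolouring.  A list of moves (v , r) recolours each listed vertex v with r
  -- (the first listed move of a vertex wins) and leaves the other vertices alone.
  Move : Set
  Move = Fin n × Fin χ

  recolour : List Move → Fin n → Fin χ
  recolour []             v = c v
  recolour ((m , r) ∷ ms) v with v ≟ m
  ... | yes _ = r
  ... | no  _ = recolour ms v

  Moved : List Move → Fin n → Set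
  Moved ms v = Any (λ mv → v ≡ proj₁ mv) ms

  recolour-view : ∀ ms v → (¬ Moved ms v × recolour ms v ≡ c v) ⊎ (v , recolour ms v) ∈ ms
  recolour-view []             v = inj₁ ((λ ()) , refl)
  recolour-view ((m , r) ∷ ms) v with v ≟ m
  ... | yes v≡m = inj₂ (here (cong (_, r) v≡m))
  ... | no  v≢m with recolour-view ms v
  ...   | inj₁ (unmoved , same) = inj₁ ((λ { (here e) → v≢m e ; (there x) → unmoved x }) , same)
  ...   | inj₂ v∈             = inj₂ (there v∈)

  Fits : List Move → Fin n → Fin χ → Set
  Fits ms m r = ∀ w → c w ≡ r → ¬ Moved ms w → ¬ Adj G m w

  Compatible : Move → Move → Set
  Compatible (m , r) (m' , r') = r ≡ r' → ¬ Adj G m m'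

  -- A list of moves that frees colour q: its conditions make the recolouring
  -- proper while leaving q unused.
  record Frees (ms : List Move) (q : Fin χ) : Set where
    field
      avoids     : All (λ mv → proj₂ mv ≢ q) ms
      empties    : ∀ w → c w ≡ q → Moved ms w
      fits       : All (λ mv → Fits ms (proj₁ mv) (proj₂ mv)) ms
      compatible : AllPairs Compatible ms

  cannotFree : ∀ {ms q} → Frees ms q → ⊥
  cannotFree {ms} {q} frees = noUnusedColour G minimal (recolour ms) recoloured-proper q unused
    where
    open Frees frees

    recoloured-proper : Proper G (recolour ms)
    recoloured-proper i j a eq with recolour-view ms i | recolour-view ms j
    ... | inj₁ (_ , ci) | inj₁ (_ , cj) = proper i j a (trans (sym ci) (trans eq cj))
    ... | inj₂ i∈ | inj₁ (j-stays , cj) = All.lookup fits i∈ j (trans (sym cj) (sym eq)) j-stays a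
    ... | inj₁ (i-stays , ci) | inj₂ j∈ = All.lookup fits j∈ i (trans (sym ci) eq) i-stays (Adj-sym a)
    ... | inj₂ i∈ | inj₂ j∈
      with allPairs-∈ compatible i∈ (subst (λ r → (j , r) ∈ ms) (sym eq) j∈)
    ...   | inj₁ refl        = Adj-irrefl i a
    ...   | inj₂ (inj₁ ij)   = ij refl a
    ...   | inj₂ (inj₂ ji)   = ji refl (Adj-sym a)

    unused : ∀ v → recolour ms v ≢ q
    unused v e with recolour-view ms v
    ... | inj₁ (stays , cv) = stays (empties v (trans (sym cv) e))
    ... | inj₂ v∈           = All.lookup avoids v∈ e

  colourUsed : ∀ r → ∃ λ v → c v ≡ r
  colourUsed r with Fin.any? (λ v → c v ≟ r)
  ... | yes used = used
  ... | no  none = ⊥-elim (noUnusedColour G minimal c proper r (λ v cv → none (v , cv)))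

  rep : Fin χ → Fin n
  rep r = proj₁ (colourUsed r)

  rep-colour : ∀ r → c (rep r) ≡ r
  rep-colour r = proj₂ (colourUsed r)

  rep-injective : Injective _≡_ _≡_ rep
  rep-injective {r} {r'} e = trans (sym (rep-colour r)) (trans (cong c e) (rep-colour r'))

  Singleton : Fin χ → Set
  Singleton q = ∀ w → c w ≡ q → w ≡ rep q

  singleton? : ∀ q → Dec (Singleton q)
  singleton? q = Fin.all? (λ w → (c w ≟ q) →-dec (w ≟ rep q))

  record PairClass (p : Fin χ) (a b : Fin n) : Set where
    field
      distinct : a ≢ b
      colour₁  : c a ≡ p
      colour₂  : c b ≡ p
      members  : ∀ w → c w ≡ p → w ≡ a ⊎ w ≡ b

  PairClass-swap : ∀ {p a b} → PairClass p a b → PairClass p b a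
  PairClass-swap pair = record
    { distinct = λ e → distinct (sym e) ; colour₁ = colour₂ ; colour₂ = colour₁
    ; members  = λ w cw → swap (members w cw) }
    where open PairClass pair

  singleton≢pair : ∀ {q p a b} → Singleton q → PairClass p a b → q ≢ p
  singleton≢pair single pair refl = distinct (trans (single _ colour₁) (sym (single _ colour₂)))
    where open PairClass pair

  Good : Fin n → Set
  Good v = ∀ q → Singleton q → c v ≢ q → Adj G v (rep q)

  Bad : Fin n → Set
  Bad v = ∃ λ q → Singleton q × c v ≢ q × ¬ Adj G v (rep q)

  good-or-bad : ∀ v → Good v ⊎ Bad v
  good-or-bad v with Fin.any? (λ q → singleton? q ×-dec ¬? (c v ≟ q) ×-dec ¬? (adj? v (rep q)))
  ... | yes bad    = inj₂ bad
  ... | no  notBad = inj₁ good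
    where
    good : Good v
    good q single c≢q with adj? v (rep q)
    ... | yes a  = a
    ... | no  na = ⊥-elim (notBad (q , single , c≢q , na))

  fitsSingleton : ∀ {ms m q} → Singleton q → ¬ Adj G m (rep q) → Fits ms m q
  fitsSingleton single na w cw _ = ¬Adj-≡ (single w cw) na

  fitsPair : ∀ {ms m p a b} → PairClass p a b → ¬ Adj G m a → ¬ Adj G m b → Fits ms m p
  fitsPair pair na nb w cw _ with PairClass.members pair w cw
  ... | inj₁ w≡a = ¬Adj-≡ w≡a na
  ... | inj₂ w≡b = ¬Adj-≡ w≡b nb

  fitsPairAfter : ∀ {ms m p a b} → PairClass p a b → Moved ms a → ¬ Adj G m b → Fits ms m p
  fitsPairAfter pair a-moves nb w cw w-stays with PairClass.members pair w cw
  ... | inj₁ refl = ⊥-elim (w-stays a-moves)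
  ... | inj₂ w≡b  = ¬Adj-≡ w≡b nb

  emptiesPair : ∀ {ms p a b} → PairClass p a b → Moved ms a → Moved ms b → ∀ w → c w ≡ p → Moved ms w
  emptiesPair pair a-moves b-moves w cw with PairClass.members pair w cw
  ... | inj₁ refl = a-moves
  ... | inj₂ refl = b-moves

  differentTargets : ∀ {m m' r r'} → r ≢ r' → Compatible (m , r) (m' , r')
  differentTargets r≢r' r≡r' = ⊥-elim (r≢r' r≡r')

  -- Two singleton classes are joined by an edge; otherwise one vertex could join the other's class.
  singletonsAdjacent : ∀ {s s'} → Singleton s → Singleton s' → s ≢ s' → Adj G (rep s) (rep s')
  singletonsAdjacent {s} {s'} single single' s≢s' with adj? (rep s) (rep s')
  ... | yes a  = a
  ... | no  na = ⊥-elim (cannotFree {(rep s' , s) ∷ []} {s'} record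
    { avoids     = s≢s' ∷ []
    ; empties    = λ w cw → here (single' w cw)
    ; fits       = fitsSingleton single (na ∘ Adj-sym) ∷ []
    ; compatible = [] ∷ [] })

  -- In a two-element class one member is good; otherwise both could move to
  -- singleton classes they miss.
  pairHasGood : ∀ {p a b} → PairClass p a b → Good a ⊎ Good b
  pairHasGood {p} {a} {b} pair with good-or-bad a | good-or-bad b
  ... | inj₁ good | _         = inj₁ good
  ... | inj₂ _    | inj₁ good = inj₂ good
  ... | inj₂ (qa , single-a , _ , na) | inj₂ (qb , single-b , _ , nb) =
    ⊥-elim (cannotFree {(a , qa) ∷ (b , qb) ∷ []} {p} record
      { avoids     = singleton≢pair single-a pair ∷ singleton≢pair single-b pair ∷ []
      ; empties    = emptiesPair pair (here refl) (there (here refl))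
      ; fits       = fitsSingleton single-a na ∷ fitsSingleton single-b nb ∷ []
      ; compatible = ((λ _ → sameColour-¬Adj (trans colour₁ (sym colour₂))) ∷ []) ∷ [] ∷ [] })
    where open PairClass pair

  record GoodPair (p : Fin χ) : Set where
    field
      good-member other : Fin n
      pair : PairClass p good-member other
      good : Good good-member

  goodPair : ∀ {p a b} → PairClass p a b → GoodPair p
  goodPair {a = a} {b} pair with pairHasGood pair
  ... | inj₁ good-a = record { good-member = a ; other = b ; pair = pair ; good = good-a }
  ... | inj₂ good-b = record { good-member = b ; other = a ; pair = PairClass-swap pair ; good = good-b }

  Transversal : (Fin χ → Fin n) → Set
  Transversal σ = ∀ r → c (σ r) ≡ r

  CliqueOn : (Fin χ → Set) → (Fin χ → Fin n) → Set
  CliqueOn P σ = ∀ r r' → r ≢ r' → P r → P r' → Adj G (σ r) (σ r')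

  transversal-injective : ∀ {σ} → Transversal σ → Injective _≡_ _≡_ σ
  transversal-injective {σ} tσ {r} {r'} e = trans (sym (tσ r)) (trans (cong c e) (tσ r'))

  cliqueAll : ∀ {P σ} → Transversal σ → (∀ r → P r) → CliqueOn P σ → HasClique G χ
  cliqueAll {σ = σ} tσ everywhere clique =
    σ , transversal-injective tσ , λ r r' r≢r' → clique r r' r≢r' (everywhere r) (everywhere r')

  cliqueOmitting : ∀ {P σ} → Transversal σ → (q : Fin χ) → (∀ r → r ≢ q → P r) → CliqueOn P σ
    → HasClique G (χ ∸ 1)
  cliqueOmitting {σ = σ} tσ q off-q clique =
    σ ∘ omit q ,
    (λ e → omit-injective q (transversal-injective tσ e)) ,
    λ i j i≢j → clique _ _ (λ e → i≢j (omit-injective q e)) (off-q _ (omit-≢ q i)) (off-q _ (omit-≢ q j))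

  singletonsClique : CliqueOn Singleton rep
  singletonsClique r r' r≢r' single single' = singletonsAdjacent single single' r≢r'

  override : (Fin χ → Fin n) → Fin χ → Fin n → Fin χ → Fin n
  override σ p v r with r ≟ p
  ... | yes _ = v
  ... | no  _ = σ r

  override-transversal : ∀ {σ p v} → Transversal σ → c v ≡ p → Transversal (override σ p v)
  override-transversal {p = p} tσ cv r with r ≟ p
  ... | yes refl = cv
  ... | no  _    = tσ r

  adj-override : ∀ {σ p v u r} → (r ≡ p → Adj G u v) → (r ≢ p → Adj G u (σ r))
    → Adj G u (override σ p v r)
  adj-override {p = p} {r = r} at-p off-p with r ≟ p
  ... | yes r≡p = at-p r≡p
  ... | no  r≢p = off-p r≢p

  either : ∀ (P : Fin χ → Set) r p → (r ≢ p → P r) → r ≡ p ⊎ P r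
  either P r p off-p with r ≟ p
  ... | yes r≡p = inj₁ r≡p
  ... | no  r≢p = inj₂ (off-p r≢p)

  orElse : ∀ (P : Fin χ → Set) {r p} → r ≢ p → r ≡ p ⊎ P r → P r
  orElse P r≢p (inj₁ r≡p) = ⊥-elim (r≢p r≡p)
  orElse P r≢p (inj₂ Pr)  = Pr

  override-clique : ∀ {P σ p v} → CliqueOn P σ → (∀ r → r ≢ p → P r → Adj G v (σ r))
    → CliqueOn (λ r → r ≡ p ⊎ P r) (override σ p v)
  override-clique {P} {p = p} clique v-adj r r' r≢r' Pr Pr' with r ≟ p | r' ≟ p
  ... | yes r≡p | yes r'≡p = ⊥-elim (r≢r' (trans r≡p (sym r'≡p)))
  ... | yes _   | no  r'≢p = v-adj r' r'≢p (orElse P r'≢p Pr')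
  ... | no  r≢p | yes _    = Adj-sym (v-adj r r≢p (orElse P r≢p Pr))
  ... | no  r≢p | no  r'≢p = clique r r' r≢r' (orElse P r≢p Pr) (orElse P r'≢p Pr')

  goodExtends : ∀ {p g} → c g ≡ p → Good g
    → CliqueOn (λ r → r ≡ p ⊎ Singleton r) (override rep p g)
  goodExtends cg good =
    override-clique singletonsClique (λ r r≢p single → good r single (λ e → r≢p (trans (sym e) cg)))

  allSingletonsClique : (∀ s → Singleton s) → HasClique G χ
  allSingletonsClique singles = cliqueAll {Singleton} rep-colour singles singletonsClique

  singletonsOmitting : ∀ q → (∀ s → s ≢ q → Singleton s) → HasClique G (χ ∸ 1)
  singletonsOmitting q others = cliqueOmitting {Singleton} rep-colour q others singletonsClique

  goodCompletes : ∀ {p g} → c g ≡ p → Good g → (∀ s → s ≢ p → Singleton s) → HasClique G χ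
  goodCompletes {p} cg good others =
    cliqueAll {λ r → r ≡ p ⊎ Singleton r} (override-transversal rep-colour cg)
      (λ r → either Singleton r p (others r)) (goodExtends cg good)

  goodOmitting : ∀ {p g} q → c g ≡ p → Good g → (∀ s → s ≢ p → s ≢ q → Singleton s)
    → HasClique G (χ ∸ 1)
  goodOmitting {p} q cg good others =
    cliqueOmitting {λ r → r ≡ p ⊎ Singleton r} (override-transversal rep-colour cg) q
      (λ r r≢q → either Singleton r p (λ r≢p → others r r≢p r≢q)) (goodExtends cg good)

  twoGoodOmitting : ∀ {p p' u v} q → c u ≡ p → c v ≡ p' → Good u → Good v → Adj G u v
    → (∀ s → s ≢ p → s ≢ p' → s ≢ q → Singleton s) → HasClique G (χ ∸ 1)
  twoGoodOmitting {p} {p'} q cu cv good-u good-v uv others =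
    cliqueOmitting {λ r → r ≡ p' ⊎ r ≡ p ⊎ Singleton r}
      (override-transversal (override-transversal rep-colour cu) cv) q
      (λ r r≢q → either (λ r → r ≡ p ⊎ Singleton r) r p' λ r≢p' →
                  either Singleton r p λ r≢p → others r r≢p r≢p' r≢q)
      (override-clique (goodExtends cu good-u) λ r r≢p' Pr →
        adj-override (λ _ → Adj-sym uv)
          (λ r≢p → good-v r (orElse Singleton r≢p Pr) (λ e → r≢p' (trans (sym e) cv))))

  threeOmitting : ∀ {p₁ p₂ p₃ h₁ h₂ h₃} q → c h₁ ≡ p₁ → c h₂ ≡ p₂ → c h₃ ≡ p₃
    → Adj G h₁ h₂ → Adj G h₂ h₃ → Adj G h₃ h₁
    → (∀ s → Singleton s → s ≢ q → Adj G h₁ (rep s))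
    → (∀ s → Singleton s → s ≢ q → Adj G h₂ (rep s))
    → (∀ s → Singleton s → s ≢ q → Adj G h₃ (rep s))
    → (∀ s → s ≢ p₁ → s ≢ p₂ → s ≢ p₃ → s ≢ q → Singleton s) → HasClique G (χ ∸ 1)
  threeOmitting {p₁} {p₂} {p₃} q c₁ c₂ c₃ h₁h₂ h₂h₃ h₃h₁ adj₁ adj₂ adj₃ others =
    cliqueOmitting {λ r → r ≡ p₃ ⊎ P₂ r}
      (override-transversal (override-transversal (override-transversal rep-colour c₁) c₂) c₃) q
      (λ r r≢q → either P₂ r p₃ λ r≢p₃ → either P₁ r p₂ λ r≢p₂ → either P₀ r p₁ λ r≢p₁ →
        others r r≢p₁ r≢p₂ r≢p₃ r≢q , r≢q)
      (override-clique {P₂}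
        (override-clique {P₁}
          (override-clique {P₀} base λ r _ P₀r → adj₁ r (proj₁ P₀r) (proj₂ P₀r))
          λ r _ P₁r → adj-override (λ _ → Adj-sym h₁h₂) λ r≢p₁ →
            let P₀r = orElse P₀ r≢p₁ P₁r in adj₂ r (proj₁ P₀r) (proj₂ P₀r))
        λ r _ P₂r → adj-override (λ _ → Adj-sym h₂h₃) λ r≢p₂ → adj-override (λ _ → h₃h₁) λ r≢p₁ →
          let P₀r = orElse P₀ r≢p₁ (orElse P₁ r≢p₂ P₂r) in adj₃ r (proj₁ P₀r) (proj₂ P₀r))
    where
    P₀ P₁ P₂ : Fin χ → Set
    P₀ r = Singleton r × r ≢ q
    P₁ r = r ≡ p₁ ⊎ P₀ r
    P₂ r = r ≡ p₂ ⊎ P₁ r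

    base : CliqueOn P₀ rep
    base r r' r≢r' (single , _) (single' , _) = singletonsClique r r' r≢r' single single'

  Extra : Fin n → Set
  Extra v = v ≢ rep (c v)

  rep-or-extra : ∀ v → v ≡ rep (c v) ⊎ Extra v
  rep-or-extra v with v ≟ rep (c v)
  ... | yes v≡rep = inj₁ v≡rep
  ... | no  extra = inj₂ extra

  extra-avoids-reps : ∀ {v} → Extra v → Avoids rep v
  extra-avoids-reps extra r refl = extra (cong rep (sym (rep-colour r)))

  extrasCount : ∀ es → AllPairs _≢_ es → All Extra es → length es + χ ≤ n
  extrasCount es distinct extras =
    freshPoints-≤ es rep-injective distinct (All.map extra-avoids-reps extras)

  Covers : List (Fin n) → Set
  Covers es = ∀ v → Extra v → v ∈ es

  coversOrNew : ∀ es → Covers es ⊎ ∃ λ v → Extra v × v ∉ es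
  coversOrNew es with Fin.any? (λ v → ¬? (v ≟ rep (c v)) ×-dec ¬? (Any.any? (v ≟_) es))
  ... | yes new = inj₂ new
  ... | no  none = inj₁ covers
    where
    covers : Covers es
    covers v extra with Any.any? (v ≟_) es
    ... | yes v∈ = v∈
    ... | no  v∉ = ⊥-elim (none (v , extra , v∉))

  coveredSingleton : ∀ {es q} → Covers es → All (λ e → c e ≢ q) es → Singleton q
  coveredSingleton covers avoid w cw with rep-or-extra w
  ... | inj₁ w≡rep = trans w≡rep (cong rep cw)
  ... | inj₂ extra = ⊥-elim (All.lookup avoid (covers w extra) cw)

  coveredPair : ∀ {es e} → Covers es → Extra e → All (λ e' → e' ≡ e ⊎ c e' ≢ c e) es
    → PairClass (c e) (rep (c e)) e
  coveredPair {e = e} covers extra alone = record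
    { distinct = λ rep≡e → extra (sym rep≡e)
    ; colour₁  = rep-colour (c e)
    ; colour₂  = refl
    ; members  = members }
    where
    members : ∀ w → c w ≡ c e → w ≡ rep (c e) ⊎ w ≡ e
    members w cw with rep-or-extra w
    ... | inj₁ w≡rep = inj₁ (trans w≡rep (cong rep cw))
    ... | inj₂ extra-w with All.lookup alone (covers w extra-w)
    ...   | inj₁ w≡e  = inj₂ w≡e
    ...   | inj₂ cw≢  = ⊥-elim (cw≢ cw)

  noExtra : Covers [] → HasClique G χ
  noExtra covers = allSingletonsClique (λ s → coveredSingleton covers [])

  -- One extra vertex e: its class is a pair with a good member, all others are singletons.
  oneExtra : ∀ {e} → Extra e → Covers (e ∷ []) → HasClique G χ
  oneExtra {e} extra covers =
    goodCompletes (PairClass.colour₁ pair) good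
      λ s s≢ce → coveredSingleton covers ((λ ce≡s → s≢ce (sym ce≡s)) ∷ [])
    where open GoodPair (goodPair (coveredPair covers extra (inj₁ refl ∷ [])))

  -- All extra vertices have colour q: the classes other than q are singletons.
  oneCrowdedClass : ∀ {es} q → Covers es → All (λ e → c e ≡ q) es → HasClique G (χ ∸ 1)
  oneCrowdedClass q covers crowded =
    singletonsOmitting q λ s s≢q →
      coveredSingleton covers (All.map (λ ce≡q ce≡s → s≢q (trans (sym ce≡s) ce≡q)) crowded)

  -- One extra vertex e is alone in its class, the others have colour q ≢ c e:
  -- the good member of the class of e extends the singleton classes other than q.
  pairBesideCrowded : ∀ {es e} q → Covers es → Extra e → c e ≢ q
    → All (λ e' → e' ≡ e ⊎ c e' ≡ q) es → HasClique G (χ ∸ 1)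
  pairBesideCrowded {e = e} q covers extra ce≢q rest =
    goodOmitting q (PairClass.colour₁ pair) good
      λ s s≢ce s≢q → coveredSingleton covers (All.map (notColour s≢ce s≢q) rest)
    where
    notColour : ∀ {s e'} → s ≢ c e → s ≢ q → e' ≡ e ⊎ c e' ≡ q → c e' ≢ s
    notColour s≢ce _   (inj₁ refl) ce≡s  = s≢ce (sym ce≡s)
    notColour _    s≢q (inj₂ ce'≡q) ce'≡s = s≢q (trans (sym ce'≡s) ce'≡q)

    otherColour : ∀ {e'} → c e' ≡ q → c e' ≢ c e
    otherColour ce'≡q ce'≡ce = ce≢q (trans (sym ce'≡ce) ce'≡q)

    open GoodPair (goodPair (coveredPair covers extra (All.map (map₂ otherColour) rest)))

  twoExtras : ∀ {e₁ e₂} → Extra e₁ → Covers (e₂ ∷ e₁ ∷ []) → HasClique G (χ ∸ 1)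
  twoExtras {e₁} {e₂} extra₁ covers with c e₁ ≟ c e₂
  ... | yes same = oneCrowdedClass (c e₁) covers (sym same ∷ refl ∷ [])
  ... | no  diff = pairBesideCrowded (c e₂) covers extra₁ diff (inj₂ refl ∷ inj₁ refl ∷ [])

  -- The recolouring obstructions below
  -- are stated for classes pᵢ = {gᵢ , hᵢ}, pⱼ = {gⱼ , hⱼ} (and pₖ = {gₖ , hₖ});
  -- in each, gⱼ and gₖ move into class pᵢ, which frees some colour unless the
  -- stated conclusion holds.

  record Absorbable (gᵢ hᵢ gⱼ gₖ : Fin n) : Set where
    field
      gⱼ-gᵢ : ¬ Adj G gⱼ gᵢ
      gⱼ-hᵢ : ¬ Adj G gⱼ hᵢ
      gₖ-gᵢ : ¬ Adj G gₖ gᵢ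
      gₖ-hᵢ : ¬ Adj G gₖ hᵢ
      gⱼ-gₖ : ¬ Adj G gⱼ gₖ

  Absorbable-swap : ∀ {gᵢ hᵢ gⱼ gₖ} → Absorbable gᵢ hᵢ gⱼ gₖ → Absorbable gᵢ hᵢ gₖ gⱼ
  Absorbable-swap a = record
    { gⱼ-gᵢ = gₖ-gᵢ ; gⱼ-hᵢ = gₖ-hᵢ ; gₖ-gᵢ = gⱼ-gᵢ ; gₖ-hᵢ = gⱼ-hᵢ ; gⱼ-gₖ = gⱼ-gₖ ∘ Adj-sym }
    where open Absorbable a

  -- After absorption hⱼ is alone in its class, so it is good: otherwise it could
  -- move to a singleton class it misses, freeing pⱼ.
  absorbedPartnerGood : ∀ {pᵢ pⱼ gᵢ hᵢ gⱼ hⱼ gₖ} → PairClass pᵢ gᵢ hᵢ → PairClass pⱼ gⱼ hⱼ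
    → pᵢ ≢ pⱼ → Absorbable gᵢ hᵢ gⱼ gₖ → Good hⱼ
  absorbedPartnerGood {pᵢ} {pⱼ} {gⱼ = gⱼ} {hⱼ} {gₖ} pairᵢ pairⱼ pᵢ≢pⱼ absorbable
    with good-or-bad hⱼ
  ... | inj₁ good = good
  ... | inj₂ (q , single , _ , hⱼ-q) =
    ⊥-elim (cannotFree {(gⱼ , pᵢ) ∷ (gₖ , pᵢ) ∷ (hⱼ , q) ∷ []} {pⱼ} record
      { avoids     = pᵢ≢pⱼ ∷ pᵢ≢pⱼ ∷ singleton≢pair single pairⱼ ∷ []
      ; empties    = emptiesPair pairⱼ (here refl) (there (there (here refl)))
      ; fits       = fitsPair pairᵢ gⱼ-gᵢ gⱼ-hᵢ ∷ fitsPair pairᵢ gₖ-gᵢ gₖ-hᵢ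
                   ∷ fitsSingleton single hⱼ-q ∷ []
      ; compatible = ((λ _ → gⱼ-gₖ) ∷ differentTargets pᵢ≢q ∷ [])
                   ∷ (differentTargets pᵢ≢q ∷ []) ∷ [] ∷ [] })
    where
    open Absorbable absorbable
    pᵢ≢q : pᵢ ≢ q
    pᵢ≢q pᵢ≡q = singleton≢pair single pairᵢ (sym pᵢ≡q)

  -- After absorption hⱼ and hₖ are both alone in their classes, so they are
  -- adjacent: otherwise hₖ could join the class of hⱼ, freeing pₖ.
  absorbedPartnersAdjacent : ∀ {pᵢ pⱼ pₖ gᵢ hᵢ gⱼ hⱼ gₖ hₖ}
    → PairClass pᵢ gᵢ hᵢ → PairClass pⱼ gⱼ hⱼ → PairClass pₖ gₖ hₖ
    → pᵢ ≢ pⱼ → pⱼ ≢ pₖ → pᵢ ≢ pₖ → Absorbable gᵢ hᵢ gⱼ gₖ → Adj G hⱼ hₖ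
  absorbedPartnersAdjacent {pᵢ} {pⱼ} {pₖ} {gⱼ = gⱼ} {hⱼ} {gₖ} {hₖ}
    pairᵢ pairⱼ pairₖ pᵢ≢pⱼ pⱼ≢pₖ pᵢ≢pₖ absorbable =
    decidable-stable (adj? hⱼ hₖ) λ hⱼ-hₖ →
      cannotFree {(gⱼ , pᵢ) ∷ (gₖ , pᵢ) ∷ (hₖ , pⱼ) ∷ []} {pₖ} record
        { avoids     = pᵢ≢pₖ ∷ pᵢ≢pₖ ∷ pⱼ≢pₖ ∷ []
        ; empties    = emptiesPair pairₖ (there (here refl)) (there (there (here refl)))
        ; fits       = fitsPair pairᵢ gⱼ-gᵢ gⱼ-hᵢ ∷ fitsPair pairᵢ gₖ-gᵢ gₖ-hᵢ
                     ∷ fitsPairAfter pairⱼ (here refl) (hⱼ-hₖ ∘ Adj-sym) ∷ []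
        ; compatible = ((λ _ → gⱼ-gₖ) ∷ differentTargets pᵢ≢pⱼ ∷ [])
                     ∷ (differentTargets pᵢ≢pⱼ ∷ []) ∷ [] ∷ [] }
    where open Absorbable absorbable

  -- If gᵢ, gⱼ, gₖ are pairwise non-adjacent, and hᵢ, hⱼ miss the singleton
  -- classes s, s', then s ≡ s': otherwise hᵢ, hⱼ move to s, s', after which gⱼ, gₖ
  -- can join class pᵢ, freeing pⱼ.
  missedSingletonsEqual : ∀ {pᵢ pⱼ gᵢ hᵢ gⱼ hⱼ gₖ s s'} → PairClass pᵢ gᵢ hᵢ → PairClass pⱼ gⱼ hⱼ
    → pᵢ ≢ pⱼ → ¬ Adj G gⱼ gᵢ → ¬ Adj G gₖ gᵢ → ¬ Adj G gⱼ gₖ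
    → Singleton s → ¬ Adj G hᵢ (rep s) → Singleton s' → ¬ Adj G hⱼ (rep s') → s ≡ s'
  missedSingletonsEqual {pᵢ} {pⱼ} {hᵢ = hᵢ} {gⱼ} {hⱼ} {gₖ} {s} {s'}
    pairᵢ pairⱼ pᵢ≢pⱼ gⱼ-gᵢ gₖ-gᵢ gⱼ-gₖ single hᵢ-s single' hⱼ-s' =
    decidable-stable (s ≟ s') λ s≢s' →
      cannotFree {(gⱼ , pᵢ) ∷ (gₖ , pᵢ) ∷ (hᵢ , s) ∷ (hⱼ , s') ∷ []} {pⱼ} record
        { avoids     = pᵢ≢pⱼ ∷ pᵢ≢pⱼ ∷ singleton≢pair single pairⱼ ∷ singleton≢pair single' pairⱼ ∷ []
        ; empties    = emptiesPair pairⱼ (here refl) (there (there (there (here refl))))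
        ; fits       = fitsPairAfter (PairClass-swap pairᵢ) (there (there (here refl))) gⱼ-gᵢ
                     ∷ fitsPairAfter (PairClass-swap pairᵢ) (there (there (here refl))) gₖ-gᵢ
                     ∷ fitsSingleton single hᵢ-s ∷ fitsSingleton single' hⱼ-s' ∷ []
        ; compatible = ((λ _ → gⱼ-gₖ) ∷ differentTargets pᵢ≢s ∷ differentTargets pᵢ≢s' ∷ [])
                     ∷ (differentTargets pᵢ≢s ∷ differentTargets pᵢ≢s' ∷ [])
                     ∷ (differentTargets s≢s' ∷ []) ∷ [] ∷ [] }
    where
    pᵢ≢s : pᵢ ≢ s
    pᵢ≢s pᵢ≡s = singleton≢pair single pairᵢ (sym pᵢ≡s)
    pᵢ≢s' : pᵢ ≢ s'
    pᵢ≢s' pᵢ≡s' = singleton≢pair single' pairᵢ (sym pᵢ≡s')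

  -- If gᵢ, gⱼ, gₖ are pairwise non-adjacent and hₖ misses a singleton class q, then
  -- hᵢ and hⱼ are adjacent: otherwise hᵢ joins class pⱼ and hₖ moves to q, after which
  -- gⱼ, gₖ can join class pᵢ, freeing pₖ.
  partnersAdjacent : ∀ {pᵢ pⱼ pₖ gᵢ hᵢ gⱼ hⱼ gₖ hₖ q}
    → PairClass pᵢ gᵢ hᵢ → PairClass pⱼ gⱼ hⱼ → PairClass pₖ gₖ hₖ
    → pᵢ ≢ pⱼ → pⱼ ≢ pₖ → pᵢ ≢ pₖ → ¬ Adj G gⱼ gᵢ → ¬ Adj G gₖ gᵢ → ¬ Adj G gⱼ gₖ
    → Singleton q → ¬ Adj G hₖ (rep q) → Adj G hᵢ hⱼ
  partnersAdjacent {pᵢ} {pⱼ} {pₖ} {hᵢ = hᵢ} {gⱼ} {hⱼ} {gₖ} {hₖ} {q}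
    pairᵢ pairⱼ pairₖ pᵢ≢pⱼ pⱼ≢pₖ pᵢ≢pₖ gⱼ-gᵢ gₖ-gᵢ gⱼ-gₖ single hₖ-q =
    decidable-stable (adj? hᵢ hⱼ) λ hᵢ-hⱼ →
      cannotFree {(gⱼ , pᵢ) ∷ (gₖ , pᵢ) ∷ (hᵢ , pⱼ) ∷ (hₖ , q) ∷ []} {pₖ} record
        { avoids     = pᵢ≢pₖ ∷ pᵢ≢pₖ ∷ pⱼ≢pₖ ∷ singleton≢pair single pairₖ ∷ []
        ; empties    = emptiesPair pairₖ (there (here refl)) (there (there (there (here refl))))
        ; fits       = fitsPairAfter (PairClass-swap pairᵢ) (there (there (here refl))) gⱼ-gᵢ
                     ∷ fitsPairAfter (PairClass-swap pairᵢ) (there (there (here refl))) gₖ-gᵢ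
                     ∷ fitsPairAfter pairⱼ (here refl) hᵢ-hⱼ ∷ fitsSingleton single hₖ-q ∷ []
        ; compatible = ((λ _ → gⱼ-gₖ) ∷ differentTargets pᵢ≢pⱼ ∷ differentTargets pᵢ≢q ∷ [])
                     ∷ (differentTargets pᵢ≢pⱼ ∷ differentTargets pᵢ≢q ∷ [])
                     ∷ (differentTargets pⱼ≢q ∷ []) ∷ [] ∷ [] }
    where
    pᵢ≢q : pᵢ ≢ q
    pᵢ≢q pᵢ≡q = singleton≢pair single pairᵢ (sym pᵢ≡q)
    pⱼ≢q : pⱼ ≢ q
    pⱼ≢q pⱼ≡q = singleton≢pair single pairⱼ (sym pⱼ≡q)

  record ThreePairs : Set where
    field
      p₁ p₂ p₃ : Fin χ
      g₁ h₁ g₂ h₂ g₃ h₃ : Fin n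
      pair₁ : PairClass p₁ g₁ h₁
      pair₂ : PairClass p₂ g₂ h₂
      pair₃ : PairClass p₃ g₃ h₃
      good₁ : Good g₁
      good₂ : Good g₂
      good₃ : Good g₃
      p₁≢p₂ : p₁ ≢ p₂
      p₂≢p₃ : p₂ ≢ p₃
      p₃≢p₁ : p₃ ≢ p₁
      others : ∀ s → s ≢ p₁ → s ≢ p₂ → s ≢ p₃ → Singleton s

  rotate : ThreePairs → ThreePairs
  rotate T = record
    { p₁ = p₂ ; p₂ = p₃ ; p₃ = p₁ ; g₁ = g₂ ; h₁ = h₂ ; g₂ = g₃ ; h₂ = h₃ ; g₃ = g₁ ; h₃ = h₁
    ; pair₁ = pair₂ ; pair₂ = pair₃ ; pair₃ = pair₁ ; good₁ = good₂ ; good₂ = good₃ ; good₃ = good₁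
    ; p₁≢p₂ = p₂≢p₃ ; p₂≢p₃ = p₃≢p₁ ; p₃≢p₁ = p₁≢p₂
    ; others = λ s s≢p₂ s≢p₃ s≢p₁ → others s s≢p₁ s≢p₂ s≢p₃ }
    where open ThreePairs T

  -- Facts about one configuration, stated for the labelling at hand; the others
  -- follow by rotating.
  module Configuration (T : ThreePairs) where
    open ThreePairs T

    Independent : Set
    Independent = ¬ Adj G g₁ g₂ × ¬ Adj G g₂ g₃ × ¬ Adj G g₃ g₁

    goodsAdjacent : Adj G g₁ g₂ → HasClique G (χ ∸ 1)
    goodsAdjacent g₁-g₂ =
      twoGoodOmitting p₃ (PairClass.colour₁ pair₁) (PairClass.colour₁ pair₂) good₁ good₂ g₁-g₂ others

    -- If h₁ is good as well, it has a good neighbour among g₂, g₃; otherwise g₂ and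
    -- g₃ can be absorbed into class p₁ and then h₂, h₃ are good and adjacent.
    goodPartner : Independent → Good h₁ → HasClique G (χ ∸ 1)
    goodPartner (g₁-g₂ , g₂-g₃ , g₃-g₁) good-h₁ with adj? h₁ g₂ | adj? h₁ g₃
    ... | yes h₁-g₂ | _ =
      twoGoodOmitting p₃ (PairClass.colour₂ pair₁) (PairClass.colour₁ pair₂) good-h₁ good₂ h₁-g₂ others
    ... | no _ | yes h₁-g₃ =
      twoGoodOmitting p₂ (PairClass.colour₂ pair₁) (PairClass.colour₁ pair₃) good-h₁ good₃ h₁-g₃
        λ s s≢p₁ s≢p₃ s≢p₂ → others s s≢p₁ s≢p₂ s≢p₃
    ... | no h₁-g₂ | no h₁-g₃ =
      twoGoodOmitting p₁ (PairClass.colour₂ pair₂) (PairClass.colour₂ pair₃)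
        (absorbedPartnerGood pair₁ pair₂ p₁≢p₂ absorbable)
        (absorbedPartnerGood pair₁ pair₃ (p₃≢p₁ ∘ sym) (Absorbable-swap absorbable))
        (absorbedPartnersAdjacent pair₁ pair₂ pair₃ p₁≢p₂ p₂≢p₃ (p₃≢p₁ ∘ sym) absorbable)
        λ s s≢p₂ s≢p₃ s≢p₁ → others s s≢p₁ s≢p₂ s≢p₃
      where
      absorbable : Absorbable g₁ h₁ g₂ g₃
      absorbable = record
        { gⱼ-gᵢ = g₁-g₂ ∘ Adj-sym ; gⱼ-hᵢ = h₁-g₂ ∘ Adj-sym ; gₖ-gᵢ = g₃-g₁
        ; gₖ-hᵢ = h₁-g₃ ∘ Adj-sym ; gⱼ-gₖ = g₂-g₃ }

    missedByPartners : Independent → ∀ {s s'} → Singleton s → ¬ Adj G h₁ (rep s)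
      → Singleton s' → ¬ Adj G h₂ (rep s') → s ≡ s'
    missedByPartners (g₁-g₂ , g₂-g₃ , g₃-g₁) =
      missedSingletonsEqual pair₁ pair₂ p₁≢p₂ (g₁-g₂ ∘ Adj-sym) g₃-g₁ g₂-g₃

    partners₁₂Adjacent : Independent → ∀ {q} → Singleton q → ¬ Adj G h₃ (rep q) → Adj G h₁ h₂
    partners₁₂Adjacent (g₁-g₂ , g₂-g₃ , g₃-g₁) =
      partnersAdjacent pair₁ pair₂ pair₃ p₁≢p₂ p₂≢p₃ (p₃≢p₁ ∘ sym) (g₁-g₂ ∘ Adj-sym) g₃-g₁ g₂-g₃

  rotate-independent : ∀ T → Configuration.Independent T → Configuration.Independent (rotate T)
  rotate-independent T (g₁-g₂ , g₂-g₃ , g₃-g₁) = g₂-g₃ , g₃-g₁ , g₁-g₂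

  -- With independent goods and all partners bad, the partners all miss the same
  -- singleton class q and are pairwise adjacent; with the singletons other than q
  -- they form a clique.
  allPartnersBad : ∀ T → Configuration.Independent T
    → Bad (ThreePairs.h₁ T) → Bad (ThreePairs.h₂ T) → Bad (ThreePairs.h₃ T) → HasClique G (χ ∸ 1)
  allPartnersBad T ind (q₁ , single₁ , _ , h₁-q₁) (q₂ , single₂ , _ , h₂-q₂) (q₃ , single₃ , _ , h₃-q₃) =
    threeOmitting q₁ (PairClass.colour₂ pair₁) (PairClass.colour₂ pair₂) (PairClass.colour₂ pair₃)
      (C.partners₁₂Adjacent T ind single₃ h₃-q₃)
      (C.partners₁₂Adjacent T′ ind′ single₁ h₁-q₁)
      (C.partners₁₂Adjacent T″ ind″ single₂ h₂-q₂)
      (λ s single → adjacentUnlessMissed λ h₁-s →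
        trans (C.missedByPartners T ind single h₁-s single₂ h₂-q₂) (sym q₁≡q₂))
      (λ s single → adjacentUnlessMissed λ h₂-s →
        trans (C.missedByPartners T′ ind′ single h₂-s single₃ h₃-q₃) (sym (trans q₁≡q₂ q₂≡q₃)))
      (λ s single → adjacentUnlessMissed λ h₃-s →
        C.missedByPartners T″ ind″ single h₃-s single₁ h₁-q₁)
      (λ s s≢p₁ s≢p₂ s≢p₃ _ → others s s≢p₁ s≢p₂ s≢p₃)
    where
    module C = Configuration
    open ThreePairs T

    T′ T″ : ThreePairs
    T′ = rotate T
    T″ = rotate T′

    ind′ : C.Independent T′
    ind′ = rotate-independent T ind
    ind″ : C.Independent T″
    ind″ = rotate-independent T′ ind′

    q₁≡q₂ : q₁ ≡ q₂
    q₁≡q₂ = C.missedByPartners T ind single₁ h₁-q₁ single₂ h₂-q₂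
    q₂≡q₃ : q₂ ≡ q₃
    q₂≡q₃ = C.missedByPartners T′ ind′ single₂ h₂-q₂ single₃ h₃-q₃

    adjacentUnlessMissed : ∀ {u s} → (¬ Adj G u (rep s) → s ≡ q₁) → s ≢ q₁ → Adj G u (rep s)
    adjacentUnlessMissed {u} {s} missed s≢q₁ = decidable-stable (adj? u (rep s)) (s≢q₁ ∘ missed)

  independentGoods : ∀ T → Configuration.Independent T → HasClique G (χ ∸ 1)
  independentGoods T ind
    with good-or-bad (ThreePairs.h₁ T) | good-or-bad (ThreePairs.h₂ T) | good-or-bad (ThreePairs.h₃ T)
  ... | inj₁ good | _ | _ = Configuration.goodPartner T ind good
  ... | inj₂ _ | inj₁ good | _ = Configuration.goodPartner (rotate T) (rotate-independent T ind) good
  ... | inj₂ _ | inj₂ _ | inj₁ good =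
    Configuration.goodPartner (rotate (rotate T))
      (rotate-independent (rotate T) (rotate-independent T ind)) good
  ... | inj₂ bad₁ | inj₂ bad₂ | inj₂ bad₃ = allPartnersBad T ind bad₁ bad₂ bad₃

  threePairsClique : ThreePairs → HasClique G (χ ∸ 1)
  threePairsClique T
    with adj? (ThreePairs.g₁ T) (ThreePairs.g₂ T) | adj? (ThreePairs.g₂ T) (ThreePairs.g₃ T)
       | adj? (ThreePairs.g₃ T) (ThreePairs.g₁ T)
  ... | yes g₁-g₂ | _ | _ = Configuration.goodsAdjacent T g₁-g₂
  ... | no _ | yes g₂-g₃ | _ = Configuration.goodsAdjacent (rotate T) g₂-g₃
  ... | no _ | no _ | yes g₃-g₁ = Configuration.goodsAdjacent (rotate (rotate T)) g₃-g₁
  ... | no g₁-g₂ | no g₂-g₃ | no g₃-g₁ = independentGoods T (g₁-g₂ , g₂-g₃ , g₃-g₁)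

  threePairs : ∀ {p₁ p₂ p₃} → GoodPair p₁ → GoodPair p₂ → GoodPair p₃ → p₁ ≢ p₂ → p₂ ≢ p₃ → p₃ ≢ p₁
    → (∀ s → s ≢ p₁ → s ≢ p₂ → s ≢ p₃ → Singleton s) → ThreePairs
  threePairs {p₁} {p₂} {p₃} P₁ P₂ P₃ p₁≢p₂ p₂≢p₃ p₃≢p₁ others = record
    { p₁ = p₁ ; p₂ = p₂ ; p₃ = p₃
    ; g₁ = GoodPair.good-member P₁ ; h₁ = GoodPair.other P₁
    ; g₂ = GoodPair.good-member P₂ ; h₂ = GoodPair.other P₂
    ; g₃ = GoodPair.good-member P₃ ; h₃ = GoodPair.other P₃
    ; pair₁ = GoodPair.pair P₁ ; pair₂ = GoodPair.pair P₂ ; pair₃ = GoodPair.pair P₃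
    ; good₁ = GoodPair.good P₁ ; good₂ = GoodPair.good P₂ ; good₃ = GoodPair.good P₃
    ; p₁≢p₂ = p₁≢p₂ ; p₂≢p₃ = p₂≢p₃ ; p₃≢p₁ = p₃≢p₁ ; others = others }

  threeExtras : ∀ {e₁ e₂ e₃} → Extra e₁ → Extra e₂ → Extra e₃ → Covers (e₃ ∷ e₂ ∷ e₁ ∷ [])
    → HasClique G (χ ∸ 1)
  threeExtras {e₁} {e₂} {e₃} x₁ x₂ x₃ covers with c e₁ ≟ c e₂ | c e₁ ≟ c e₃ | c e₂ ≟ c e₃
  ... | yes c₁≡c₂ | yes c₁≡c₃ | _ =
    oneCrowdedClass (c e₁) covers (sym c₁≡c₃ ∷ sym c₁≡c₂ ∷ refl ∷ [])
  ... | yes c₁≡c₂ | no c₁≢c₃ | _ =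
    pairBesideCrowded (c e₁) covers x₃ (c₁≢c₃ ∘ sym) (inj₁ refl ∷ inj₂ (sym c₁≡c₂) ∷ inj₂ refl ∷ [])
  ... | no c₁≢c₂ | yes c₁≡c₃ | _ =
    pairBesideCrowded (c e₁) covers x₂ (c₁≢c₂ ∘ sym) (inj₂ (sym c₁≡c₃) ∷ inj₁ refl ∷ inj₂ refl ∷ [])
  ... | no c₁≢c₂ | no _ | yes c₂≡c₃ =
    pairBesideCrowded (c e₂) covers x₁ c₁≢c₂ (inj₂ (sym c₂≡c₃) ∷ inj₂ refl ∷ inj₁ refl ∷ [])
  ... | no c₁≢c₂ | no c₁≢c₃ | no c₂≢c₃ =
    threePairsClique (threePairs (goodPair pair₁) (goodPair pair₂) (goodPair pair₃)
                                 c₁≢c₂ c₂≢c₃ (c₁≢c₃ ∘ sym) others)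
    where
    pair₁ : PairClass (c e₁) (rep (c e₁)) e₁
    pair₁ = coveredPair covers x₁ (inj₂ (c₁≢c₃ ∘ sym) ∷ inj₂ (c₁≢c₂ ∘ sym) ∷ inj₁ refl ∷ [])
    pair₂ : PairClass (c e₂) (rep (c e₂)) e₂
    pair₂ = coveredPair covers x₂ (inj₂ (c₂≢c₃ ∘ sym) ∷ inj₁ refl ∷ inj₂ c₁≢c₂ ∷ [])
    pair₃ : PairClass (c e₃) (rep (c e₃)) e₃
    pair₃ = coveredPair covers x₃ (inj₁ refl ∷ inj₂ c₂≢c₃ ∷ inj₂ c₁≢c₃ ∷ [])
    others : ∀ s → s ≢ c e₁ → s ≢ c e₂ → s ≢ c e₃ → Singleton s
    others s s≢c₁ s≢c₂ s≢c₃ = coveredSingleton covers ((s≢c₃ ∘ sym) ∷ (s≢c₂ ∘ sym) ∷ (s≢c₁ ∘ sym) ∷ [])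

  CliqueWithRoom : ℕ → Set
  CliqueWithRoom j = HasClique G (χ ∸ j) × 2 * j + χ ≤ n

  extend-distinct : ∀ {v : Fin n} {es} → v ∉ es → AllPairs _≢_ es → AllPairs _≢_ (v ∷ es)
  extend-distinct {es = es} v∉ distinct = ¬Any⇒All¬ es v∉ ∷ distinct

  certificate : CliqueWithRoom 0 ⊎ CliqueWithRoom 1 ⊎ 4 + χ ≤ n
  certificate with coversOrNew []
  ... | inj₁ covers = inj₁ (noExtra covers , extrasCount [] [] [])
  ... | inj₂ (e₁ , x₁ , _) with coversOrNew (e₁ ∷ [])
  ...   | inj₁ covers = inj₁ (oneExtra x₁ covers , extrasCount [] [] [])
  ...   | inj₂ (e₂ , x₂ , e₂∉) with coversOrNew (e₂ ∷ e₁ ∷ [])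
  ...     | inj₁ covers =
    inj₂ (inj₁ (twoExtras x₁ covers , extrasCount _ distinct₂ (x₂ ∷ x₁ ∷ [])))
    where
    distinct₂ : AllPairs _≢_ (e₂ ∷ e₁ ∷ [])
    distinct₂ = extend-distinct e₂∉ ([] ∷ [])
  ...     | inj₂ (e₃ , x₃ , e₃∉) with coversOrNew (e₃ ∷ e₂ ∷ e₁ ∷ [])
  ...       | inj₁ covers =
    inj₂ (inj₁ (threeExtras x₁ x₂ x₃ covers ,
                ≤-trans (n≤1+n _) (extrasCount _ distinct₃ (x₃ ∷ x₂ ∷ x₁ ∷ []))))
    where
    distinct₃ : AllPairs _≢_ (e₃ ∷ e₂ ∷ e₁ ∷ [])
    distinct₃ = extend-distinct e₃∉ (extend-distinct e₂∉ ([] ∷ []))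
  ...       | inj₂ (e₄ , x₄ , e₄∉) =
    inj₂ (inj₂ (extrasCount _ distinct₄ (x₄ ∷ x₃ ∷ x₂ ∷ x₁ ∷ [])))
    where
    distinct₄ : AllPairs _≢_ (e₄ ∷ e₃ ∷ e₂ ∷ e₁ ∷ [])
    distinct₄ = extend-distinct e₄∉ (extend-distinct e₃∉ (extend-distinct e₂∉ ([] ∷ [])))

lemma2p1 : ∀ (n : ℕ) (G : Graph n) (ω χ : ℕ)
    → IsCliqueNumber G ω → IsChromaticNumber G χ
    → χ ∸ ω ≤ 2
    → χ + 2 * (χ ∸ ω) ≤ n
lemma2p1 n G ω χ (_ , maximum) ((c , proper) , minimal) deficit≤2
  with OptimalColouring.certificate G c proper minimal
... | inj₁ (clique , room)        = deficitBound {ω = ω} 0 (deficit-≤ χ 0 ω (maximum χ clique)) room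
... | inj₂ (inj₁ (clique , room)) = deficitBound {ω = ω} 1 (deficit-≤ χ 1 ω (maximum (χ ∸ 1) clique)) room
... | inj₂ (inj₂ room)            = deficitBound {ω = ω} 2 deficit≤2 room
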